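{- Let $I$ be a finite simple graph and let $a,b\in V(I)$ be adjacent vertices such that $a$ has degree one. Then \[ {}^\partial\varepsilon_{I}(z)={}^\partial\varepsilon_{I-a}(z)+2z^2\,{}^\partial\varepsilon_{I-a-b}(z). \]
   Context: For a finite simple graph $I$ with adjacency matrix $M_I$ over $\mathbb{Z}_2$ (entry $1$ iff the two vertices are adjacent, zero diagonal), and $A\subseteq V(I)$, let $M_A$ be the principal submatrix of $M_I$ indexed by $A$ (the adjacency matrix of the induced subgraph on $A$), and $A^c=V(I)\setminus A$. The partial-dual genus polynomial of $I$ is ${}^\partial\varepsilon_I(z)=\sum_{A\subseteq V(I)} z^{\operatorname{rank}(M_A)+\operatorname{rank}(M_{A^c})}$, where rank is over $\mathbb{Z}_2$ and the empty matrix has rank $0$ (so the graph with no vertices has polynomial $1$). $I-a$ denotes the graph obtained from $I$ by deleting the vertex $a$ and its incident edges, and $I-a-b$ the graph obtained by deleting both $a$ and $b$. -}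

module Defs where

open import Data.Nat using (ℕ; zero; suc; _+_; _*_; _⊔_; _≡ᵇ_)
open import Data.Bool using (Bool; true; false; _∧_; _∨_; _xor_; not; if_then_else_)
open import Data.Fin using (Fin; punchIn; punchOut)
open import Data.Vec using (Vec; []; _∷_; lookup; tabulate; foldr; zipWith; map)
open import Data.List as List using (List; _++_)
open import Relation.Binary.PropositionalEquality using (_≡_; _≢_; refl; trans; sym)
open import Data.Empty using (⊥)

record SimpleGraph (n : ℕ) : Set where
  field
    adj    : Fin n → Fin n → Bool
    symm   : ∀ i j → adj i j ≡ adj j i
    irrefl : ∀ i → adj i i ≡ false
open SimpleGraph public

count : ∀ {n} → Vec Bool n → ℕ
count = foldr _ (λ b r → (if b then 1 else 0) + r) 0

degree : ∀ {n} → SimpleGraph n → Fin n → ℕ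
degree I a = count (tabulate (adj I a))

deleteVertex : ∀ {m} → SimpleGraph (suc m) → Fin (suc m) → SimpleGraph m
deleteVertex I a = record
  { adj    = λ i j → adj I (punchIn a i) (punchIn a j)
  ; symm   = λ i j → symm I (punchIn a i) (punchIn a j)
  ; irrefl = λ i → irrefl I (punchIn a i) }

adj⇒≢ : ∀ {n} (I : SimpleGraph n) {a b : Fin n} → adj I a b ≡ true → a ≢ b
adj⇒≢ I {a} {b} h refl with trans (sym h) (irrefl I a)
... | ()

deleteTwo : ∀ {m} (I : SimpleGraph (suc (suc m))) (a b : Fin (suc (suc m))) → a ≢ b → SimpleGraph m
deleteTwo I a b a≢b = deleteVertex (deleteVertex I a) (punchOut a≢b)

Subset : ℕ → Set
Subset n = Vec Bool n

allSubsets : ∀ n → List (Subset n)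
allSubsets zero    = [] List.∷ List.[]
allSubsets (suc n) = List.map (false ∷_) (allSubsets n) ++ List.map (true ∷_) (allSubsets n)

complement : ∀ {n} → Subset n → Subset n
complement = map not

_⊆ᵇ_ : ∀ {n} → Subset n → Subset n → Bool
[] ⊆ᵇ [] = true
(s ∷ S) ⊆ᵇ (a ∷ A) = (not s ∨ a) ∧ (S ⊆ᵇ A)

anyV : ∀ {n} → Vec Bool n → Bool
anyV = foldr _ _∨_ false

parity : ∀ {n} → Vec Bool n → Bool
parity = foldr _ _xor_ false

allL : ∀ {A : Set} → (A → Bool) → List A → Bool
allL p = List.foldr (λ x r → p x ∧ r) true

filterᵇ : ∀ {A : Set} → (A → Bool) → List A → List A
filterᵇ p = List.foldr (λ x r → if p x then x List.∷ r else r) List.[]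

maxL : List ℕ → ℕ
maxL = List.foldr _⊔_ 0

-- For the principal submatrix M_A of the adjacency matrix, the rows indexed
-- by S ⊆ A are linearly independent over Z_2 iff for every nonempty T ⊆ S
-- the sum (over Z_2) of the rows indexed by T, restricted to the columns in
-- A, is a nonzero vector, i.e. some column j ∈ A has odd sum.
rowsIndependent : ∀ {n} → SimpleGraph n → Subset n → Subset n → Bool
rowsIndependent {n} I A S =
  allL (λ T → not (T ⊆ᵇ S ∧ anyV T)
              ∨ anyV (tabulate λ j → lookup A j ∧ parity (zipWith _∧_ T (tabulate λ i → adj I i j))))
       (allSubsets n)

-- rank over Z_2 of M_A = maximal number of linearly independent rows of M_A
-- (the empty matrix has rank 0).
rankSub : ∀ {n} → SimpleGraph n → Subset n → ℕ
rankSub {n} I A =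
  maxL (List.map count
         (filterᵇ (λ S → (S ⊆ᵇ A) ∧ rowsIndependent I A S) (allSubsets n)))

Poly : Set
Poly = ℕ → ℕ

-- coefficient of z^k in the partial-dual genus polynomial:
-- the number of A ⊆ V(I) with rank(M_A) + rank(M_{A^c}) = k.
partialDualGenusPoly : ∀ {n} → SimpleGraph n → Poly
partialDualGenusPoly {n} I k =
  List.length (filterᵇ (λ A → (rankSub I A + rankSub I (complement A)) ≡ᵇ k) (allSubsets n))

_+ₚ_ : Poly → Poly → Poly
(p +ₚ q) k = p k + q k

twoZ²* : Poly → Poly
twoZ²* p zero = 0
twoZ²* p (suc zero) = 0
twoZ²* p (suc (suc k)) = 2 * p k

module Submission where

-- Sort the subsets A of V(I) by whether they contain a and b. If A contains exactly one
-- of them, then in M_A and in M_{A^c} the vertex a is absent or has no neighbour, so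
-- deleting it changes neither rank; these subsets give the polynomial of I - a. If A
-- contains both, then since b is the only neighbour of a, rank M_A is 2 plus the rank of
-- M_{A - a - b} in I - a - b, while A^c contains neither and its rank is read off in
-- I - a - b directly; symmetrically when A contains neither. So every subset of
-- V(I - a - b) is counted twice with its exponent raised by 2.

open import Defs
open import Algebra using (CommutativeRing)
import Algebra.Properties.CommutativeSemigroup as CommutativeSemigroupProperties
open import Data.Bool using (Bool; true; false; _∧_; _∨_; _xor_; not; if_then_else_)
open import Data.Bool.Properties using (xor-∧-commutativeRing; xor-same; xor-identityʳ; ∧-distribʳ-xor; ¬-not; ∧-zeroʳ; ∧-identityʳ)
open import Data.Empty using (⊥; ⊥-elim)
open import Data.Fin using (Fin; zero; suc; punchIn; punchOut; _≟_)
open import Data.Fin.Properties using (punchIn-punchOut; punchIn-injective; punchInᵢ≢i)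
open import Data.List as List using (List; _++_)
open import Data.List.Membership.Propositional using (_∈_)
open import Data.List.Membership.Propositional.Properties using (∈-map⁺; ∈-map⁻; ∈-++⁺ˡ; ∈-++⁺ʳ)
open import Data.List.Properties using (length-++; length-map)
open import Data.List.Relation.Unary.Any using (here; there)
open import Data.Nat using (ℕ; zero; suc; _+_; _≤_; _≡ᵇ_; z≤n; s≤s)
open import Data.Nat.Properties using (suc-injective; +-commutativeSemigroup; ≤-refl; ≤-trans; ≤-antisym; n≤1+n; +-identityʳ; ⊔-lub; m≤m⊔n; m≤n⊔m; ⊔-sel; ≤-reflexive)
open import Data.Nat.Tactic.RingSolver using (solve-∀)
open import Data.Product using (∃; _×_; _,_; proj₁; proj₂)
open import Data.Sum using (_⊎_; inj₁; inj₂)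
open import Data.Vec using (Vec; []; _∷_; lookup; tabulate; foldr; zipWith; replicate; insertAt; removeAt)
open import Data.Vec.Properties using (insertAt-lookup; insertAt-punchIn; insertAt-removeAt; map-insertAt; lookup∘tabulate; lookup-replicate; lookup-zipWith)
open import Function using (case_of_)
open import Relation.Nullary using (yes; no)
open import Relation.Binary.PropositionalEquality using (_≡_; _≢_; refl; sym; trans; cong; cong₂; subst; module ≡-Reasoning)

private
  variable
    n k : ℕ

  module ℕ+ = CommutativeSemigroupProperties +-commutativeSemigroup
  module ⊕ = CommutativeSemigroupProperties (CommutativeRing.+-commutativeSemigroup xor-∧-commutativeRing)

false≢true : false ≢ true
false≢true ()

∧-true⁻ : ∀ {x y} → x ∧ y ≡ true → x ≡ true × y ≡ true
∧-true⁻ {true} {true} _ = refl , refl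

data PunchInView (a : Fin (suc n)) : Fin (suc n) → Set where
  at      : PunchInView a a
  punched : ∀ j → PunchInView a (punchIn a j)

punchInView : (a j : Fin (suc n)) → PunchInView a j
punchInView a j with a ≟ j
... | yes refl = at
... | no a≢j   = subst (PunchInView a) (punchIn-punchOut a≢j) (punched (punchOut a≢j))

insertAt-elim : {X : Set} (P : Vec X (suc n) → Set) (a : Fin (suc n)) →
                (∀ xs x → P (insertAt xs a x)) → ∀ ys → P ys
insertAt-elim P a h ys = subst P (insertAt-removeAt ys a) (h (removeAt ys a) (lookup ys a))

tabulate-insertAt : {X : Set} (f : Fin (suc n) → X) (a : Fin (suc n)) →
                    tabulate f ≡ insertAt (tabulate (λ i → f (punchIn a i))) a (f a)
tabulate-insertAt f zero = refl
tabulate-insertAt {n = suc n} f (suc a) = cong (f zero ∷_) (tabulate-insertAt (λ i → f (suc i)) a)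

zipWith-insertAt : {X Y Z : Set} (f : X → Y → Z) (xs : Vec X n) (ys : Vec Y n) (a : Fin (suc n)) (x : X) (y : Y) →
                   zipWith f (insertAt xs a x) (insertAt ys a y) ≡ insertAt (zipWith f xs ys) a (f x y)
zipWith-insertAt f xs ys zero x y = refl
zipWith-insertAt f (x′ ∷ xs) (y′ ∷ ys) (suc a) x y = cong (f x′ y′ ∷_) (zipWith-insertAt f xs ys a x y)

foldr-insertAt : {X B : Set} (f : X → B → B) (e : B) → (∀ x y z → f x (f y z) ≡ f y (f x z)) →
                 (xs : Vec X n) (a : Fin (suc n)) (x : X) →
                 foldr (λ _ → B) f e (insertAt xs a x) ≡ f x (foldr (λ _ → B) f e xs)
foldr-insertAt f e comm xs zero x = refl
foldr-insertAt f e comm (x′ ∷ xs) (suc a) x =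
  trans (cong (f x′) (foldr-insertAt f e comm xs a x)) (comm x′ x _)

count-insertAt : (xs : Subset n) (a : Fin (suc n)) (x : Bool) → count (insertAt xs a x) ≡ count (x ∷ xs)
count-insertAt = foldr-insertAt _ 0 (λ x y → ℕ+.x∙yz≈y∙xz (if x then 1 else 0) (if y then 1 else 0))

parity-insertAt : (xs : Subset n) (a : Fin (suc n)) (x : Bool) → parity (insertAt xs a x) ≡ parity (x ∷ xs)
parity-insertAt = foldr-insertAt _xor_ false ⊕.x∙yz≈y∙xz

count-cons≤ : ∀ x (xs : Subset n) → count (x ∷ xs) ≤ suc (count xs)
count-cons≤ true  xs = ≤-refl
count-cons≤ false xs = n≤1+n _

count≡0⇒empty : (xs : Subset n) → count xs ≡ 0 → ∀ i → lookup xs i ≡ false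
count≡0⇒empty (false ∷ xs) h zero    = refl
count≡0⇒empty (false ∷ xs) h (suc i) = count≡0⇒empty xs h i

_⊆_ : Subset n → Subset n → Set
T ⊆ S = ∀ i → lookup T i ≡ true → lookup S i ≡ true

Nonempty : Subset n → Set
Nonempty T = ∃ λ i → lookup T i ≡ true

∅ : Subset n
∅ = replicate _ false

∅-empty : ∀ (i : Fin n) → lookup ∅ i ≢ true
∅-empty i p = false≢true (trans (sym (lookup-replicate i false)) p)

count-∅ : ∀ n → count (∅ {n}) ≡ 0
count-∅ zero    = refl
count-∅ (suc n) = count-∅ n

⊆-insertAt⁺ : ∀ {T S : Subset n} {x y} (a : Fin (suc n)) →
              (x ≡ true → y ≡ true) → T ⊆ S → insertAt T a x ⊆ insertAt S a y
⊆-insertAt⁺ {T = T} {S} {x} {y} a x⇒y T⊆S i with punchInView a i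
... | at = λ p → trans (insertAt-lookup S a y) (x⇒y (trans (sym (insertAt-lookup T a x)) p))
... | punched j = λ p → trans (insertAt-punchIn S a y j) (T⊆S j (trans (sym (insertAt-punchIn T a x j)) p))

⊆-insertAt⁻ : ∀ {T S : Subset n} {x y} (a : Fin (suc n)) →
              insertAt T a x ⊆ insertAt S a y → (x ≡ true → y ≡ true) × T ⊆ S
⊆-insertAt⁻ {T = T} {S} {x} {y} a h =
  (λ p → trans (sym (insertAt-lookup S a y)) (h a (trans (insertAt-lookup T a x) p))) ,
  (λ j p → trans (sym (insertAt-punchIn S a y j)) (h (punchIn a j) (trans (insertAt-punchIn T a x j) p)))

nonempty-insertAt⁺ : ∀ {T : Subset n} {x} (a : Fin (suc n)) → Nonempty T → Nonempty (insertAt T a x)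
nonempty-insertAt⁺ {T = T} {x} a (j , p) = punchIn a j , trans (insertAt-punchIn T a x j) p

nonempty-insertAt⁻ : ∀ {T : Subset n} {x} (a : Fin (suc n)) → Nonempty (insertAt T a x) → x ≡ true ⊎ Nonempty T
nonempty-insertAt⁻ {T = T} {x} a (i , p) with punchInView a i
... | at        = inj₁ (trans (sym (insertAt-lookup T a x)) p)
... | punched j = inj₂ (j , trans (sym (insertAt-punchIn T a x j)) p)

singleton-⊆ : (S : Subset (suc n)) (r : Fin (suc n)) → lookup S r ≡ true → insertAt ∅ r true ⊆ S
singleton-⊆ S r r∈S i with punchInView r i
... | at        = λ _ → r∈S
... | punched j = λ p → ⊥-elim (∅-empty j (trans (sym (insertAt-punchIn ∅ r true j)) p))

xor-⊆ : (T U S : Subset n) → T ⊆ S → U ⊆ S → zipWith _xor_ T U ⊆ S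
xor-⊆ T U S T⊆S U⊆S i p with lookup T i in eqT | lookup U i in eqU
... | true  | _    = T⊆S i eqT
... | false | true = U⊆S i eqU
... | false | false = ⊥-elim (false≢true (trans (sym (trans (lookup-zipWith _xor_ i T U) (cong₂ _xor_ eqT eqU))) p))

anyV-true⁻ : (v : Subset n) → anyV v ≡ true → Nonempty v
anyV-true⁻ (true ∷ v)  _ = zero , refl
anyV-true⁻ (false ∷ v) h with anyV-true⁻ v h
... | i , p = suc i , p

anyV-true⁺ : (v : Subset n) → Nonempty v → anyV v ≡ true
anyV-true⁺ (true ∷ v)  _             = refl
anyV-true⁺ (false ∷ v) (suc i , p)   = anyV-true⁺ v (i , p)

anyV-false⁻ : (v : Subset n) → anyV v ≡ false → ∀ i → lookup v i ≡ false
anyV-false⁻ (false ∷ v) h zero    = refl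
anyV-false⁻ (false ∷ v) h (suc i) = anyV-false⁻ v h i

nonempty-or-empty : (T : Subset n) → Nonempty T ⊎ (∀ i → lookup T i ≡ false)
nonempty-or-empty T with anyV T in eq
... | true  = inj₁ (anyV-true⁻ T eq)
... | false = inj₂ (anyV-false⁻ T eq)

⊆ᵇ-true⁻ : (T S : Subset n) → (T ⊆ᵇ S) ≡ true → T ⊆ S
⊆ᵇ-true⁻ (true ∷ T) (s ∷ S) h zero    _ = proj₁ (∧-true⁻ {s} h)
⊆ᵇ-true⁻ (t ∷ T) (s ∷ S) h (suc i) p = ⊆ᵇ-true⁻ T S (proj₂ (∧-true⁻ h)) i p

⊆ᵇ-true⁺ : (T S : Subset n) → T ⊆ S → (T ⊆ᵇ S) ≡ true
⊆ᵇ-true⁺ []      []      _ = refl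
⊆ᵇ-true⁺ (false ∷ T) (s ∷ S) h = ⊆ᵇ-true⁺ T S (λ i → h (suc i))
⊆ᵇ-true⁺ (true ∷ T)  (s ∷ S) h rewrite h zero refl = ⊆ᵇ-true⁺ T S (λ i → h (suc i))

NonzeroOn : Subset k → (Fin k → Bool) → Set
NonzeroOn C v = ∃ λ j → lookup C j ≡ true × v j ≡ true

ZeroOn : Subset k → (Fin k → Bool) → Set
ZeroOn C v = ∀ j → lookup C j ≡ true → v j ≡ false

zeroOn⇒¬nonzeroOn : (C : Subset k) (v : Fin k → Bool) → ZeroOn C v → NonzeroOn C v → ⊥
zeroOn⇒¬nonzeroOn C v v₀ (j , j∈C , vj) = false≢true (trans (sym (v₀ j j∈C)) vj)

nonzeroOn-resp : (C : Subset k) {v w : Fin k → Bool} → (∀ j → v j ≡ w j) → NonzeroOn C v → NonzeroOn C w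
nonzeroOn-resp C v≗w (j , j∈C , vj) = j , j∈C , trans (sym (v≗w j)) vj

restrict : Subset k → (Fin k → Bool) → Subset k
restrict C v = tabulate λ j → lookup C j ∧ v j

lookup-restrict : (C : Subset k) (v : Fin k → Bool) (j : Fin k) → lookup (restrict C v) j ≡ (lookup C j ∧ v j)
lookup-restrict C v = lookup∘tabulate (λ j → lookup C j ∧ v j)

nonzeroOnᵇ : Subset k → (Fin k → Bool) → Bool
nonzeroOnᵇ C v = anyV (restrict C v)

nonzeroOnᵇ-true⁻ : (C : Subset k) (v : Fin k → Bool) → nonzeroOnᵇ C v ≡ true → NonzeroOn C v
nonzeroOnᵇ-true⁻ C v h with anyV-true⁻ (restrict C v) h
... | j , p = j , ∧-true⁻ (trans (sym (lookup-restrict C v j)) p)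

nonzeroOnᵇ-true⁺ : (C : Subset k) (v : Fin k → Bool) → NonzeroOn C v → nonzeroOnᵇ C v ≡ true
nonzeroOnᵇ-true⁺ C v (j , j∈C , vj) =
  anyV-true⁺ (restrict C v) (j , trans (lookup-restrict C v j) (cong₂ _∧_ j∈C vj))

nonzeroOnᵇ-false⁻ : (C : Subset k) (v : Fin k → Bool) → nonzeroOnᵇ C v ≡ false → ZeroOn C v
nonzeroOnᵇ-false⁻ C v h j j∈C =
  ∧-false (trans (sym (lookup-restrict C v j)) (anyV-false⁻ (restrict C v) h j)) j∈C
  where
  ∧-false : ∀ {x y} → x ∧ y ≡ false → x ≡ true → y ≡ false
  ∧-false h refl = h

nonzeroOn-or-zeroOn : (C : Subset k) (v : Fin k → Bool) → NonzeroOn C v ⊎ ZeroOn C v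
nonzeroOn-or-zeroOn C v with nonzeroOnᵇ C v in eq
... | true  = inj₁ (nonzeroOnᵇ-true⁻ C v eq)
... | false = inj₂ (nonzeroOnᵇ-false⁻ C v eq)

nonzeroOn-insertAt⁻ : (C : Subset k) (c : Fin (suc k)) (x : Bool) (v : Fin (suc k) → Bool) →
                      NonzeroOn (insertAt C c x) v →
                      (x ≡ true × v c ≡ true) ⊎ NonzeroOn C (λ j → v (punchIn c j))
nonzeroOn-insertAt⁻ C c x v (i , i∈ , vi) with punchInView c i
... | at        = inj₁ (trans (sym (insertAt-lookup C c x)) i∈ , vi)
... | punched j = inj₂ (j , trans (sym (insertAt-punchIn C c x j)) i∈ , vi)

nonzeroOn-insertAt⁺ : (C : Subset k) (c : Fin (suc k)) (x : Bool) (v : Fin (suc k) → Bool) →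
                      NonzeroOn C (λ j → v (punchIn c j)) → NonzeroOn (insertAt C c x) v
nonzeroOn-insertAt⁺ C c x v (j , j∈C , vj) = punchIn c j , trans (insertAt-punchIn C c x j) j∈C , vj

zeroOn-insertAt⁺ : (C : Subset k) (c : Fin (suc k)) (x : Bool) (v : Fin (suc k) → Bool) →
                   v c ≡ false → ZeroOn C (λ j → v (punchIn c j)) → ZeroOn (insertAt C c x) v
zeroOn-insertAt⁺ C c x v vc zeroOn i i∈ with punchInView c i
... | at        = vc
... | punched j = zeroOn j (trans (sym (insertAt-punchIn C c x j)) i∈)

-- Row sums and linear independence over ℤ₂

Matrix : ℕ → ℕ → Set
Matrix n k = Fin n → Fin k → Bool

deleteRow : Matrix (suc n) k → Fin (suc n) → Matrix n k
deleteRow M r i = M (punchIn r i)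

deleteColumn : Matrix n (suc k) → Fin (suc k) → Matrix n k
deleteColumn M c i j = M i (punchIn c j)

rowSum : Matrix n k → Subset n → Fin k → Bool
rowSum M T j = parity (zipWith _∧_ T (tabulate λ i → M i j))

rowSum-insertAt : (M : Matrix (suc n) k) (T : Subset n) (r : Fin (suc n)) (x : Bool) (j : Fin k) →
                  rowSum M (insertAt T r x) j ≡ (x ∧ M r j) xor rowSum (deleteRow M r) T j
rowSum-insertAt M T r x j = begin
  parity (zipWith _∧_ (insertAt T r x) (tabulate λ i → M i j))
    ≡⟨ cong (λ col → parity (zipWith _∧_ (insertAt T r x) col)) (tabulate-insertAt (λ i → M i j) r) ⟩
  parity (zipWith _∧_ (insertAt T r x) (insertAt (tabulate λ i → M (punchIn r i) j) r (M r j)))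
    ≡⟨ cong parity (zipWith-insertAt _∧_ T _ r x (M r j)) ⟩
  parity (insertAt (zipWith _∧_ T (tabulate λ i → M (punchIn r i) j)) r (x ∧ M r j))
    ≡⟨ parity-insertAt _ r _ ⟩
  (x ∧ M r j) xor rowSum (deleteRow M r) T j ∎
  where open ≡-Reasoning

rowSum-xor : (M : Matrix n k) (T U : Subset n) (j : Fin k) →
             rowSum M (zipWith _xor_ T U) j ≡ rowSum M T j xor rowSum M U j
rowSum-xor M T U j = go T U (tabulate λ i → M i j)
  where
  go : ∀ {n} (T U col : Subset n) →
       parity (zipWith _∧_ (zipWith _xor_ T U) col) ≡ parity (zipWith _∧_ T col) xor parity (zipWith _∧_ U col)
  go []      []      []        = refl
  go (t ∷ T) (u ∷ U) (c ∷ col) = begin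
    ((t xor u) ∧ c) xor parity (zipWith _∧_ (zipWith _xor_ T U) col)
      ≡⟨ cong₂ _xor_ (∧-distribʳ-xor c t u) (go T U col) ⟩
    ((t ∧ c) xor (u ∧ c)) xor (parity (zipWith _∧_ T col) xor parity (zipWith _∧_ U col))
      ≡⟨ ⊕.interchange (t ∧ c) (u ∧ c) _ _ ⟩
    ((t ∧ c) xor parity (zipWith _∧_ T col)) xor ((u ∧ c) xor parity (zipWith _∧_ U col)) ∎
    where open ≡-Reasoning

rowSum-zero : (M : Matrix n k) (T : Subset n) (j : Fin k) →
              (∀ i → lookup T i ≡ true → M i j ≡ false) → rowSum M T j ≡ false
rowSum-zero M T j h = go T (tabulate λ i → M i j) (λ i p → trans (lookup∘tabulate _ i) (h i p))
  where
  go : ∀ {n} (T col : Subset n) → (∀ i → lookup T i ≡ true → lookup col i ≡ false) →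
       parity (zipWith _∧_ T col) ≡ false
  go []          []        h = refl
  go (false ∷ T) (c ∷ col) h = go T col (λ i → h (suc i))
  go (true ∷ T)  (c ∷ col) h rewrite h zero refl = go T col (λ i → h (suc i))

rowSum-singleton : (M : Matrix (suc n) k) (r : Fin (suc n)) (j : Fin k) → rowSum M (insertAt ∅ r true) j ≡ M r j
rowSum-singleton M r j = begin
  rowSum M (insertAt ∅ r true) j          ≡⟨ rowSum-insertAt M ∅ r true j ⟩
  M r j xor rowSum (deleteRow M r) ∅ j    ≡⟨ cong (M r j xor_) (rowSum-zero (deleteRow M r) ∅ j λ i p → ⊥-elim (∅-empty i p)) ⟩
  M r j xor false                         ≡⟨ xor-identityʳ (M r j) ⟩
  M r j ∎
  where open ≡-Reasoning

∈-allSubsets : (v : Subset n) → v ∈ allSubsets n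
∈-allSubsets []          = here refl
∈-allSubsets (false ∷ v) = ∈-++⁺ˡ (∈-map⁺ (false ∷_) (∈-allSubsets v))
∈-allSubsets {suc n} (true ∷ v) =
  ∈-++⁺ʳ (List.map (false ∷_) (allSubsets n)) (∈-map⁺ (true ∷_) (∈-allSubsets v))

module _ {X : Set} (p : X → Bool) where

  allL-true⁻ : ∀ xs → allL p xs ≡ true → ∀ {x} → x ∈ xs → p x ≡ true
  allL-true⁻ (y List.∷ xs) h (here refl) = proj₁ (∧-true⁻ h)
  allL-true⁻ (y List.∷ xs) h (there x∈) = allL-true⁻ xs (proj₂ (∧-true⁻ {p y} h)) x∈

  allL-true⁺ : ∀ xs → (∀ x → p x ≡ true) → allL p xs ≡ true
  allL-true⁺ List.[]       h = refl
  allL-true⁺ (y List.∷ xs) h rewrite h y = allL-true⁺ xs h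

  allL-false⁻ : ∀ xs → allL p xs ≡ false → ∃ λ x → p x ≡ false
  allL-false⁻ (y List.∷ xs) h with p y in eq
  ... | false = y , eq
  ... | true  = allL-false⁻ xs h

  ∈-filterᵇ⁺ : ∀ xs {x} → x ∈ xs → p x ≡ true → x ∈ filterᵇ p xs
  ∈-filterᵇ⁺ (y List.∷ xs) (here refl) px rewrite px = here refl
  ∈-filterᵇ⁺ (y List.∷ xs) (there x∈) px with p y
  ... | true  = there (∈-filterᵇ⁺ xs x∈ px)
  ... | false = ∈-filterᵇ⁺ xs x∈ px

  ∈-filterᵇ⁻ : ∀ xs {x} → x ∈ filterᵇ p xs → p x ≡ true
  ∈-filterᵇ⁻ (y List.∷ xs) x∈ with p y in eq
  ∈-filterᵇ⁻ (y List.∷ xs) (here refl) | true = eq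
  ∈-filterᵇ⁻ (y List.∷ xs) (there x∈)  | true = ∈-filterᵇ⁻ xs x∈
  ∈-filterᵇ⁻ (y List.∷ xs) x∈          | false = ∈-filterᵇ⁻ xs x∈

maxL-upper : ∀ xs {x} → x ∈ xs → x ≤ maxL xs
maxL-upper (y List.∷ xs) (here refl) = m≤m⊔n y (maxL xs)
maxL-upper (y List.∷ xs) (there x∈)  = ≤-trans (maxL-upper xs x∈) (m≤n⊔m y (maxL xs))

maxL-least : ∀ xs {r} → (∀ {x} → x ∈ xs → x ≤ r) → maxL xs ≤ r
maxL-least List.[]       h = z≤n
maxL-least (y List.∷ xs) h = ⊔-lub (h (here refl)) (maxL-least xs (λ x∈ → h (there x∈)))

maxL-attained : ∀ xs → maxL xs ≡ 0 ⊎ maxL xs ∈ xs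
maxL-attained List.[] = inj₁ refl
maxL-attained (y List.∷ xs) with ⊔-sel y (maxL xs)
... | inj₁ eq rewrite eq = inj₂ (here refl)
... | inj₂ eq rewrite eq with maxL-attained xs
...   | inj₁ ≡0   = inj₁ ≡0
...   | inj₂ ∈xs  = inj₂ (there ∈xs)

Independent : Matrix n k → Subset k → Subset n → Set
Independent M C S = ∀ T → T ⊆ S → Nonempty T → NonzeroOn C (rowSum M T)

independenceTestᵇ : Matrix n k → Subset k → Subset n → Subset n → Bool
independenceTestᵇ M C S T = not (T ⊆ᵇ S ∧ anyV T) ∨ nonzeroOnᵇ C (rowSum M T)

independentᵇ : Matrix n k → Subset k → Subset n → Bool
independentᵇ {n} M C S = allL (independenceTestᵇ M C S) (allSubsets n)

independentᵇ-true⁻ : (M : Matrix n k) (C : Subset k) (S : Subset n) →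
                     independentᵇ M C S ≡ true → Independent M C S
independentᵇ-true⁻ M C S h T T⊆S T≠∅
  with allL-true⁻ (independenceTestᵇ M C S) (allSubsets _) h (∈-allSubsets T)
... | clause rewrite ⊆ᵇ-true⁺ T S T⊆S | anyV-true⁺ T T≠∅ = nonzeroOnᵇ-true⁻ C (rowSum M T) clause

independentᵇ-true⁺ : (M : Matrix n k) (C : Subset k) (S : Subset n) →
                     Independent M C S → independentᵇ M C S ≡ true
independentᵇ-true⁺ M C S ind = allL-true⁺ (independenceTestᵇ M C S) (allSubsets _) clause
  where
  clause : ∀ T → independenceTestᵇ M C S T ≡ true
  clause T with T ⊆ᵇ S in T⊆S | anyV T in T≠∅
  ... | false | _     = refl
  ... | true  | false = refl
  ... | true  | true  = nonzeroOnᵇ-true⁺ C (rowSum M T) (ind T (⊆ᵇ-true⁻ T S T⊆S) (anyV-true⁻ T T≠∅))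

independenceTestᵇ-false⁻ : (M : Matrix n k) (C : Subset k) (S T : Subset n) → independenceTestᵇ M C S T ≡ false →
                           T ⊆ S × Nonempty T × ZeroOn C (rowSum M T)
independenceTestᵇ-false⁻ M C S T h with T ⊆ᵇ S in T⊆S | anyV T in T≠∅ | nonzeroOnᵇ C (rowSum M T) in zero
... | true | true | false = ⊆ᵇ-true⁻ T S T⊆S , anyV-true⁻ T T≠∅ , nonzeroOnᵇ-false⁻ C (rowSum M T) zero

independent-or-dependent : (M : Matrix n k) (C : Subset k) (S : Subset n) →
  Independent M C S ⊎ ∃ λ T → T ⊆ S × Nonempty T × ZeroOn C (rowSum M T)
independent-or-dependent M C S with independentᵇ M C S in eq
... | true  = inj₁ (independentᵇ-true⁻ M C S eq)
... | false with allL-false⁻ (independenceTestᵇ M C S) (allSubsets _) eq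
...   | T , T-fails = inj₂ (T , independenceTestᵇ-false⁻ M C S T T-fails)

independent⇒row-nonzero : (M : Matrix (suc n) k) (C : Subset k) (S : Subset (suc n)) (r : Fin (suc n)) →
                          Independent M C S → lookup S r ≡ true → NonzeroOn C (M r)
independent⇒row-nonzero M C S r ind r∈S = nonzeroOn-resp C (rowSum-singleton M r)
  (ind (insertAt ∅ r true) (singleton-⊆ S r r∈S) (r , insertAt-lookup ∅ r true))

-- Every nonempty T ⊆ S whose row sum vanishes on C has odd sum in column c, so the sum of
-- T and T★ vanishes on all of insertAt C c true, which independence of S forbids.
independent-dropRow : (M : Matrix (suc n) (suc k)) (C : Subset k) (c : Fin (suc k))
  (S : Subset n) (x : Fin (suc n)) (T★ : Subset (suc n)) →
  Independent M (insertAt C c true) (insertAt S x true) → T★ ⊆ insertAt S x true → lookup T★ x ≡ true →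
  ZeroOn C (rowSum (deleteColumn M c) T★) → Independent (deleteColumn M c) C (insertAt S x false)
independent-dropRow {n = n} M C c S x T★ ind T★⊆S x∈T★ T★-zero T T⊆S₀ T≠∅
  with nonzeroOn-or-zeroOn C (rowSum (deleteColumn M c) T)
... | inj₁ nonzero = nonzero
... | inj₂ T-zero  = ⊥-elim (zeroOn⇒¬nonzeroOn (insertAt C c true) (rowSum M D) D-zero
                                    (ind D (xor-⊆ T T★ (insertAt S x true) T⊆S T★⊆S) D≠∅))
  where
  oddInColumn-c : ∀ U → U ⊆ insertAt S x true → Nonempty U → ZeroOn C (rowSum (deleteColumn M c) U) →
                  rowSum M U c ≡ true
  oddInColumn-c U U⊆S U≠∅ U-zero with nonzeroOn-insertAt⁻ C c true (rowSum M U) (ind U U⊆S U≠∅)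
  ... | inj₁ (_ , sum) = sum
  ... | inj₂ nonzero   = ⊥-elim (zeroOn⇒¬nonzeroOn C (rowSum (deleteColumn M c) U) U-zero nonzero)

  T⊆S : T ⊆ insertAt S x true
  T⊆S i p = ⊆-insertAt⁺ x (λ ()) (λ _ q → q) i (T⊆S₀ i p)

  D : Subset (suc n)
  D = zipWith _xor_ T T★

  x∉T : lookup T x ≡ false
  x∉T = ¬-not λ x∈T → false≢true (trans (sym (insertAt-lookup S x false)) (T⊆S₀ x x∈T))

  D≠∅ : Nonempty D
  D≠∅ = x , trans (lookup-zipWith _xor_ x T T★) (cong₂ _xor_ x∉T x∈T★)

  D-zero : ZeroOn (insertAt C c true) (rowSum M D)
  D-zero = zeroOn-insertAt⁺ C c true (rowSum M D)
    (trans (rowSum-xor M T T★ c)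
           (cong₂ _xor_ (oddInColumn-c T T⊆S T≠∅ T-zero) (oddInColumn-c T★ T★⊆S (x , x∈T★) T★-zero)))
    (λ j j∈C → trans (rowSum-xor M T T★ (punchIn c j)) (cong₂ _xor_ (T-zero j j∈C) (T★-zero j j∈C)))

independent-deleteColumn : (M : Matrix n (suc k)) (C : Subset k) (c : Fin (suc k)) (S : Subset n) →
  Independent M (insertAt C c true) S →
  ∃ λ S₀ → S₀ ⊆ S × Independent (deleteColumn M c) C S₀ × count S ≤ suc (count S₀)
independent-deleteColumn M C c S ind with independent-or-dependent (deleteColumn M c) C S
... | inj₁ ind₀ = S , (λ _ p → p) , ind₀ , n≤1+n (count S)
independent-deleteColumn {n = zero}  M C c S ind | inj₂ (_ , _ , (() , _) , _)
independent-deleteColumn {n = suc n} M C c S ind | inj₂ (T★ , T★⊆S , (x , x∈T★) , T★-zero) =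
  insertAt S′ x false , S₀⊆S ,
  independent-dropRow M C c S′ x T★ (subst (Independent M (insertAt C c true)) (sym S≡) ind)
                      (subst (T★ ⊆_) (sym S≡) T★⊆S) x∈T★ T★-zero ,
  ≤-reflexive count-S
  where
  open ≡-Reasoning
  S′ : Subset n
  S′ = removeAt S x

  S≡ : insertAt S′ x true ≡ S
  S≡ = trans (cong (insertAt S′ x) (sym (T★⊆S x x∈T★))) (insertAt-removeAt S x)

  S₀⊆S : insertAt S′ x false ⊆ S
  S₀⊆S = subst (insertAt S′ x false ⊆_) S≡ (⊆-insertAt⁺ x (λ ()) (λ _ p → p))

  count-S : count S ≡ suc (count (insertAt S′ x false))
  count-S = begin
    count S                              ≡⟨ cong count (sym S≡) ⟩
    count (insertAt S′ x true)           ≡⟨ count-insertAt S′ x true ⟩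
    suc (count S′)                       ≡⟨ cong suc (count-insertAt S′ x false) ⟨
    suc (count (insertAt S′ x false))    ∎

IndependentRowsOf : SimpleGraph n → Subset n → Subset n → Set
IndependentRowsOf I A S = S ⊆ A × Independent (adj I) A S

module _ (I : SimpleGraph n) (A : Subset n) where

  private
    selected : Subset n → Bool
    selected S = (S ⊆ᵇ A) ∧ rowsIndependent I A S

    selected⁻ : ∀ S → selected S ≡ true → IndependentRowsOf I A S
    selected⁻ S h = ⊆ᵇ-true⁻ S A (proj₁ (∧-true⁻ h)) , independentᵇ-true⁻ (adj I) A S (proj₂ (∧-true⁻ h))

    candidates : List ℕ
    candidates = List.map count (filterᵇ selected (allSubsets n))

  count≤rankSub : ∀ S → IndependentRowsOf I A S → count S ≤ rankSub I A
  count≤rankSub S (S⊆A , ind) =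
    maxL-upper candidates (∈-map⁺ count (∈-filterᵇ⁺ selected (allSubsets n) (∈-allSubsets S)
      (cong₂ _∧_ (⊆ᵇ-true⁺ S A S⊆A) (independentᵇ-true⁺ (adj I) A S ind))))

  rankSub-least : ∀ r → (∀ S → IndependentRowsOf I A S → count S ≤ r) → rankSub I A ≤ r
  rankSub-least r h = maxL-least candidates λ x∈ → case ∈-map⁻ count x∈ of λ where
    (S , S∈ , refl) → h S (selected⁻ S (∈-filterᵇ⁻ selected (allSubsets n) S∈))

  rankSub-attained : ∃ λ S → IndependentRowsOf I A S × count S ≡ rankSub I A
  rankSub-attained with maxL-attained candidates
  ... | inj₁ rank≡0 =
    ∅ , ((λ i p → ⊥-elim (∅-empty i p)) , λ T T⊆∅ (i , p) → ⊥-elim (∅-empty i (T⊆∅ i p))) ,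
    trans (count-∅ n) (sym rank≡0)
  ... | inj₂ rank∈ with ∈-map⁻ count rank∈
  ...   | S , S∈ , rank≡ = S , selected⁻ S (∈-filterᵇ⁻ selected (allSubsets n) S∈) , sym rank≡

-- Deleting an absent or isolated vertex

module _ (I : SimpleGraph (suc n)) (a : Fin (suc n)) (x : Bool) (B : Subset n)
         (isolated : x ≡ true → ∀ j → lookup B j ≡ true → adj I a (punchIn a j) ≡ false) where

  private
    M : Matrix (suc n) (suc n)
    M = adj I

    A : Subset (suc n)
    A = insertAt B a x

    I₋ : SimpleGraph n
    I₋ = deleteVertex I a

    row-a-zero : x ≡ true → ZeroOn A (M a)
    row-a-zero x≡true = zeroOn-insertAt⁺ B a x (M a) (irrefl I a) (isolated x≡true)

    column-a-zero : x ≡ true → ∀ T → T ⊆ B → rowSum (deleteRow M a) T a ≡ false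
    column-a-zero x≡true T T⊆B =
      rowSum-zero (deleteRow M a) T a λ i i∈T → trans (symm I _ a) (isolated x≡true i (T⊆B i i∈T))

  independent-deleteVertex⁻ : ∀ S → S ⊆ B → Independent M A (insertAt S a false) →
                              Independent (adj I₋) B S
  independent-deleteVertex⁻ S S⊆B ind T T⊆S T≠∅
    with nonzeroOn-insertAt⁻ B a x (rowSum (deleteRow M a) T)
           (nonzeroOn-resp A (rowSum-insertAt M T a false)
             (ind (insertAt T a false) (⊆-insertAt⁺ a (λ p → p) T⊆S) (nonempty-insertAt⁺ a T≠∅)))
  ... | inj₁ (x≡true , sum) =
    ⊥-elim (false≢true (trans (sym (column-a-zero x≡true T (λ i p → S⊆B i (T⊆S i p)))) sum))
  ... | inj₂ nonzero = nonzero

  independent-deleteVertex⁺ : ∀ S → Independent (adj I₋) B S → Independent M A (insertAt S a false)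
  independent-deleteVertex⁺ S ind =
    insertAt-elim (λ T → T ⊆ insertAt S a false → Nonempty T → NonzeroOn A (rowSum M T)) a go
    where
    go : ∀ T t → insertAt T a t ⊆ insertAt S a false → Nonempty (insertAt T a t) →
         NonzeroOn A (rowSum M (insertAt T a t))
    go T true  T⊆S _ = ⊥-elim (false≢true (proj₁ (⊆-insertAt⁻ a T⊆S) refl))
    go T false T⊆S T≠∅ with nonempty-insertAt⁻ a T≠∅
    ... | inj₂ T′≠∅ =
      nonzeroOn-resp A (λ j → sym (rowSum-insertAt M T a false j))
        (nonzeroOn-insertAt⁺ B a x (rowSum (deleteRow M a) T) (ind T (proj₂ (⊆-insertAt⁻ a T⊆S)) T′≠∅))

  rankSub-deleteVertex : rankSub I A ≡ rankSub I₋ B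
  rankSub-deleteVertex = ≤-antisym
    (rankSub-least I A _ (insertAt-elim (λ S → IndependentRowsOf I A S → count S ≤ rankSub I₋ B) a bound))
    (rankSub-least I₋ B _ λ S (S⊆B , ind) →
      subst (_≤ rankSub I A) (count-insertAt S a false)
        (count≤rankSub I A (insertAt S a false) (⊆-insertAt⁺ a (λ ()) S⊆B , independent-deleteVertex⁺ S ind)))
    where
    bound : ∀ S s → IndependentRowsOf I A (insertAt S a s) → count (insertAt S a s) ≤ rankSub I₋ B
    bound S true  (S⊆A , ind) =
      ⊥-elim (zeroOn⇒¬nonzeroOn A (M a) (row-a-zero (proj₁ (⊆-insertAt⁻ a S⊆A) refl))
               (independent⇒row-nonzero M A (insertAt S a true) a ind (insertAt-lookup S a true)))
    bound S false (S⊆A , ind) = subst (_≤ rankSub I₋ B) (sym (count-insertAt S a false))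
      (count≤rankSub I₋ B S (S⊆B , independent-deleteVertex⁻ S S⊆B ind))
      where
      S⊆B : S ⊆ B
      S⊆B = proj₂ (⊆-insertAt⁻ a S⊆A)

filterᵇ-++ : {X : Set} (p : X → Bool) (xs ys : List X) → filterᵇ p (xs ++ ys) ≡ filterᵇ p xs ++ filterᵇ p ys
filterᵇ-++ p List.[]       ys = refl
filterᵇ-++ p (x List.∷ xs) ys with p x
... | true  = cong (x List.∷_) (filterᵇ-++ p xs ys)
... | false = filterᵇ-++ p xs ys

filterᵇ-map : {X Y : Set} (p : Y → Bool) (f : X → Y) (xs : List X) →
              filterᵇ p (List.map f xs) ≡ List.map f (filterᵇ (λ x → p (f x)) xs)
filterᵇ-map p f List.[]       = refl
filterᵇ-map p f (x List.∷ xs) with p (f x)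
... | true  = cong (f x List.∷_) (filterᵇ-map p f xs)
... | false = filterᵇ-map p f xs

countSubsets : (Subset n → Bool) → ℕ
countSubsets {n} p = List.length (filterᵇ p (allSubsets n))

countSubsets-cong : (p q : Subset n → Bool) → (∀ V → p V ≡ q V) → countSubsets p ≡ countSubsets q
countSubsets-cong {n} p q p≗q = cong List.length (go (allSubsets n))
  where
  go : ∀ xs → filterᵇ p xs ≡ filterᵇ q xs
  go List.[]       = refl
  go (x List.∷ xs) rewrite p≗q x with q x
  ... | true  = cong (x List.∷_) (go xs)
  ... | false = go xs

countSubsets-none : (p : Subset n → Bool) → (∀ V → p V ≡ false) → countSubsets p ≡ 0
countSubsets-none {n} p none = cong List.length (go (allSubsets n))
  where
  go : ∀ xs → filterᵇ p xs ≡ List.[]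
  go List.[]       = refl
  go (x List.∷ xs) rewrite none x = go xs

countSubsets-insertAt : (p : Subset (suc n) → Bool) (a : Fin (suc n)) →
  countSubsets p ≡ countSubsets (λ V → p (insertAt V a false)) + countSubsets (λ V → p (insertAt V a true))
countSubsets-insertAt {n} p zero = begin
  List.length (filterᵇ p (withHead false ++ withHead true))
    ≡⟨ cong List.length (filterᵇ-++ p (withHead false) (withHead true)) ⟩
  List.length (filterᵇ p (withHead false) ++ filterᵇ p (withHead true))
    ≡⟨ length-++ (filterᵇ p (withHead false)) ⟩
  List.length (filterᵇ p (withHead false)) + List.length (filterᵇ p (withHead true))
    ≡⟨ cong₂ _+_ (length-withHead false) (length-withHead true) ⟩
  countSubsets (λ V → p (false ∷ V)) + countSubsets (λ V → p (true ∷ V)) ∎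
  where
  open ≡-Reasoning
  withHead : Bool → List (Subset (suc n))
  withHead x = List.map (x ∷_) (allSubsets n)

  length-withHead : ∀ x → List.length (filterᵇ p (withHead x)) ≡ countSubsets (λ V → p (x ∷ V))
  length-withHead x = trans (cong List.length (filterᵇ-map p (x ∷_) (allSubsets n)))
                            (length-map (x ∷_) (filterᵇ (λ V → p (x ∷ V)) (allSubsets n)))
countSubsets-insertAt {suc n} p (suc a) = begin
  countSubsets p
    ≡⟨ countSubsets-insertAt p zero ⟩
  countSubsets (λ V → p (false ∷ V)) + countSubsets (λ V → p (true ∷ V))
    ≡⟨ cong₂ _+_ (countSubsets-insertAt (λ V → p (false ∷ V)) a)
                 (countSubsets-insertAt (λ V → p (true ∷ V)) a) ⟩
  (c false false + c false true) + (c true false + c true true)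
    ≡⟨ ℕ+.interchange (c false false) (c false true) (c true false) (c true true) ⟩
  (c false false + c true false) + (c false true + c true true)
    ≡⟨ cong₂ _+_ (countSubsets-insertAt (λ V → p (insertAt V (suc a) false)) zero)
                 (countSubsets-insertAt (λ V → p (insertAt V (suc a) true)) zero) ⟨
  countSubsets (λ V → p (insertAt V (suc a) false)) + countSubsets (λ V → p (insertAt V (suc a) true)) ∎
  where
  open ≡-Reasoning
  c : Bool → Bool → ℕ
  c x y = countSubsets (λ V → p (x ∷ insertAt V a y))

subsetPoly : (Subset n → ℕ) → Poly
subsetPoly f k = countSubsets (λ A → f A ≡ᵇ k)

subsetPoly-cong : {f g : Subset n → ℕ} → (∀ V → f V ≡ g V) → ∀ k → subsetPoly f k ≡ subsetPoly g k
subsetPoly-cong {f = f} {g} f≗g k =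
  countSubsets-cong (λ A → f A ≡ᵇ k) (λ A → g A ≡ᵇ k) λ V → cong (_≡ᵇ k) (f≗g V)

subsetPoly-insertAt : (f : Subset (suc n) → ℕ) (a : Fin (suc n)) →
  ∀ k → subsetPoly f k ≡ (subsetPoly (λ V → f (insertAt V a false))
                           +ₚ subsetPoly (λ V → f (insertAt V a true))) k
subsetPoly-insertAt f a k = countSubsets-insertAt (λ A → f A ≡ᵇ k) a

twoZ²*-subsetPoly : (f : Subset n → ℕ) →
  ∀ k → twoZ²* (subsetPoly f) k ≡ (subsetPoly (λ A → 2 + f A) +ₚ subsetPoly (λ A → 2 + f A)) k
twoZ²*-subsetPoly f zero          = sym (cong₂ _+_ none none)
  where
  none : subsetPoly (λ A → 2 + f A) 0 ≡ 0
  none = countSubsets-none (λ A → (2 + f A) ≡ᵇ 0) (λ _ → refl)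
twoZ²*-subsetPoly f (suc zero)    = sym (cong₂ _+_ none none)
  where
  none : subsetPoly (λ A → 2 + f A) 1 ≡ 0
  none = countSubsets-none (λ A → (2 + f A) ≡ᵇ 1) (λ _ → refl)
twoZ²*-subsetPoly f (suc (suc k)) = cong (subsetPoly f k +_) (+-identityʳ (subsetPoly f k))

partialDualGenus : SimpleGraph n → Subset n → ℕ
partialDualGenus I A = rankSub I A + rankSub I (complement A)

complement-insertAt : (V : Subset n) (a : Fin (suc n)) (x : Bool) →
                      complement (insertAt V a x) ≡ insertAt (complement V) a (not x)
complement-insertAt V a x = map-insertAt not x V a

-- A vertex of degree one and its neighbour

module _ {m} (I : SimpleGraph (suc (suc m))) (a : Fin (suc (suc m))) (b′ : Fin (suc m))
         (a-b : adj I a (punchIn a b′) ≡ true) (a-leaf : ∀ j → adj I a (punchIn a (punchIn b′ j)) ≡ false) where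

  private
    M : Matrix (suc (suc m)) (suc (suc m))
    M = adj I

    b : Fin (suc (suc m))
    b = punchIn a b′

    e : Fin m → Fin (suc (suc m))
    e j = punchIn a (punchIn b′ j)

    I₂ : SimpleGraph m
    I₂ = deleteVertex (deleteVertex I a) b′

    R : Matrix m (suc (suc m))
    R = deleteRow (deleteRow M a) b′

  placeAB : Bool → Bool → Subset m → Subset (suc (suc m))
  placeAB x y V = insertAt (insertAt V b′ y) a x

  private
    placeAB-elim : (P : Subset (suc (suc m)) → Set) → (∀ x y V → P (placeAB x y V)) → ∀ S → P S
    placeAB-elim P h = insertAt-elim P a λ W x → insertAt-elim (λ W → P (insertAt W a x)) b′ (λ V y → h x y V) W

    lookup-a : ∀ x y V → lookup (placeAB x y V) a ≡ x
    lookup-a x y V = insertAt-lookup _ a x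

    lookup-b : ∀ x y V → lookup (placeAB x y V) b ≡ y
    lookup-b x y V = trans (insertAt-punchIn _ a x b′) (insertAt-lookup V b′ y)

    lookup-e : ∀ x y V j → lookup (placeAB x y V) (e j) ≡ lookup V j
    lookup-e x y V j = trans (insertAt-punchIn _ a x _) (insertAt-punchIn V b′ y j)

    ⊆-placeAB⁺ : ∀ {x y V x′ y′ W} → (x ≡ true → x′ ≡ true) → (y ≡ true → y′ ≡ true) → V ⊆ W →
                 placeAB x y V ⊆ placeAB x′ y′ W
    ⊆-placeAB⁺ x⇒x′ y⇒y′ V⊆W = ⊆-insertAt⁺ a x⇒x′ (⊆-insertAt⁺ b′ y⇒y′ V⊆W)

    ⊆-placeAB⁻ : ∀ {x y V x′ y′ W} → placeAB x y V ⊆ placeAB x′ y′ W → V ⊆ W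
    ⊆-placeAB⁻ h = proj₂ (⊆-insertAt⁻ b′ (proj₂ (⊆-insertAt⁻ a h)))

    count-placeAB : ∀ x y V → count (placeAB x y V) ≡ count (x ∷ y ∷ V)
    count-placeAB x y V = trans (count-insertAt _ a x) (cong ((if x then 1 else 0) +_) (count-insertAt V b′ y))

    rowSum-placeAB : ∀ x y T j → rowSum M (placeAB x y T) j ≡ (x ∧ M a j) xor ((y ∧ M b j) xor rowSum R T j)
    rowSum-placeAB x y T j =
      trans (rowSum-insertAt M (insertAt T b′ y) a x j)
            (cong ((x ∧ M a j) xor_) (rowSum-insertAt (deleteRow M a) T b′ y j))

    rowSum-placeAB-a : ∀ x y T → rowSum M (placeAB x y T) a ≡ y
    rowSum-placeAB-a x y T = begin
      rowSum M (placeAB x y T) a                       ≡⟨ rowSum-placeAB x y T a ⟩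
      (x ∧ M a a) xor ((y ∧ M b a) xor rowSum R T a)   ≡⟨ cong₂ (λ p q → (x ∧ p) xor ((y ∧ q) xor rowSum R T a))
                                                                 (irrefl I a) (trans (symm I b a) a-b) ⟩
      (x ∧ false) xor ((y ∧ true) xor rowSum R T a)    ≡⟨ cong₂ _xor_ (∧-zeroʳ x)
                                                                 (cong₂ _xor_ (∧-identityʳ y) column-a-zero) ⟩
      y xor false                                      ≡⟨ xor-identityʳ y ⟩
      y                                                ∎
      where
      open ≡-Reasoning
      column-a-zero : rowSum R T a ≡ false
      column-a-zero = rowSum-zero R T a λ i _ → trans (symm I (e i) a) (a-leaf i)

    rowSum-placeAB-b : ∀ x y T → rowSum M (placeAB x y T) b ≡ x xor rowSum R T b
    rowSum-placeAB-b x y T = begin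
      rowSum M (placeAB x y T) b                       ≡⟨ rowSum-placeAB x y T b ⟩
      (x ∧ M a b) xor ((y ∧ M b b) xor rowSum R T b)   ≡⟨ cong₂ (λ p q → (x ∧ p) xor ((y ∧ q) xor rowSum R T b))
                                                                 a-b (irrefl I b) ⟩
      (x ∧ true) xor ((y ∧ false) xor rowSum R T b)    ≡⟨ cong₂ (λ p q → p xor (q xor rowSum R T b))
                                                                 (∧-identityʳ x) (∧-zeroʳ y) ⟩
      x xor rowSum R T b                               ∎
      where open ≡-Reasoning

    rowSum-placeAB-e : ∀ x T j → rowSum M (placeAB x false T) (e j) ≡ rowSum (adj I₂) T j
    rowSum-placeAB-e x T j = begin
      rowSum M (placeAB x false T) (e j)          ≡⟨ rowSum-placeAB x false T (e j) ⟩
      (x ∧ M a (e j)) xor rowSum R T (e j)        ≡⟨ cong (λ p → (x ∧ p) xor rowSum R T (e j)) (a-leaf j) ⟩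
      (x ∧ false) xor rowSum R T (e j)            ≡⟨ cong (_xor rowSum R T (e j)) (∧-zeroʳ x) ⟩
      rowSum (adj I₂) T j                         ∎
      where open ≡-Reasoning

  module _ (A₀ : Subset m) where

    private
      A : Subset (suc (suc m))
      A = placeAB true true A₀

    independent-placeAB⁺ : ∀ S → Independent (adj I₂) A₀ S → Independent M A (placeAB true true S)
    independent-placeAB⁺ S ind =
      placeAB-elim (λ T → T ⊆ placeAB true true S → Nonempty T → NonzeroOn A (rowSum M T)) go
      where
      go : ∀ t u T → placeAB t u T ⊆ placeAB true true S → Nonempty (placeAB t u T) →
           NonzeroOn A (rowSum M (placeAB t u T))
      go t true  T _   _   = a , lookup-a true true A₀ , rowSum-placeAB-a t true T
      go t false T T⊆S T≠∅ with nonempty-or-empty T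
      ... | inj₁ T′≠∅ with ind T (⊆-placeAB⁻ T⊆S) T′≠∅
      ...   | j , j∈A₀ , sum = e j , trans (lookup-e true true A₀ j) j∈A₀ , trans (rowSum-placeAB-e t T j) sum
      go true false T _ _ | inj₂ T-empty =
        b , lookup-b true true A₀ ,
        trans (rowSum-placeAB-b true false T)
              (cong (true xor_) (rowSum-zero R T b λ i p → ⊥-elim (false≢true (trans (sym (T-empty i)) p))))
      go false false T _ T≠∅ | inj₂ T-empty with nonempty-insertAt⁻ a T≠∅
      ... | inj₂ W≠∅ with nonempty-insertAt⁻ b′ W≠∅
      ...   | inj₂ (i , p) = ⊥-elim (false≢true (trans (sym (T-empty i)) p))

    -- Adding row a with coefficient rowSum R T b cancels column b, and column a only meets
    -- row b, so the row sum can only be nonzero on A₀.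
    independent-placeAB-with-a⁻ : ∀ u S → Independent M A (placeAB true u S) → Independent (adj I₂) A₀ S
    independent-placeAB-with-a⁻ u S ind T T⊆S T≠∅
      with nonzeroOn-insertAt⁻ (insertAt A₀ b′ true) a true (rowSum M (placeAB (rowSum R T b) false T))
             (ind (placeAB (rowSum R T b) false T) (⊆-placeAB⁺ (λ _ → refl) (λ ()) T⊆S)
                  (nonempty-insertAt⁺ a (nonempty-insertAt⁺ b′ T≠∅)))
    ... | inj₁ (_ , sum) = ⊥-elim (false≢true (trans (sym (rowSum-placeAB-a _ false T)) sum))
    ... | inj₂ nonzero with nonzeroOn-insertAt⁻ A₀ b′ true _ nonzero
    ...   | inj₁ (_ , sum) =
      ⊥-elim (false≢true (trans (sym (trans (rowSum-placeAB-b _ false T) (xor-same (rowSum R T b)))) sum))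
    ...   | inj₂ nonzero₀ = nonzeroOn-resp A₀ (rowSum-placeAB-e _ T) nonzero₀

    independent-placeAB-without-a⁻ : ∀ u S → Independent M A (placeAB false u S) →
                                     Independent (deleteColumn R a) (insertAt A₀ b′ true) S
    independent-placeAB-without-a⁻ u S ind T T⊆S T≠∅
      with nonzeroOn-insertAt⁻ (insertAt A₀ b′ true) a true (rowSum M (placeAB false false T))
             (ind (placeAB false false T) (⊆-placeAB⁺ (λ ()) (λ ()) T⊆S)
                  (nonempty-insertAt⁺ a (nonempty-insertAt⁺ b′ T≠∅)))
    ... | inj₁ (_ , sum) = ⊥-elim (false≢true (trans (sym (rowSum-placeAB-a false false T)) sum))
    ... | inj₂ nonzero   =
      nonzeroOn-resp (insertAt A₀ b′ true) (λ j → rowSum-placeAB false false T (punchIn a j)) nonzero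

    -- Upper bound: if a ∈ S, then S minus a and b stays independent in I - a - b; if a ∉ S,
    -- the rows of S other than b are independent with column b added to A₀, so dropping one
    -- of them makes them independent in I - a - b.
    rankSub-placeAB : rankSub I A ≡ 2 + rankSub I₂ A₀
    rankSub-placeAB = ≤-antisym
      (rankSub-least I A _ (placeAB-elim (λ S → IndependentRowsOf I A S → count S ≤ 2 + rankSub I₂ A₀) bound))
      (case rankSub-attained I₂ A₀ of λ where
        (S₀ , (S₀⊆A₀ , ind₀) , count≡rank) →
          subst (_≤ rankSub I A) (trans (count-placeAB true true S₀) (cong (2 +_) count≡rank))
            (count≤rankSub I A (placeAB true true S₀)
              (⊆-placeAB⁺ (λ p → p) (λ p → p) S₀⊆A₀ , independent-placeAB⁺ S₀ ind₀)))
      where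
      bound : ∀ t u S → IndependentRowsOf I A (placeAB t u S) → count (placeAB t u S) ≤ 2 + rankSub I₂ A₀
      bound t u S (S⊆A , ind) rewrite count-placeAB t u S with t
      ... | true  = s≤s (≤-trans (count-cons≤ u S)
                      (s≤s (count≤rankSub I₂ A₀ S (⊆-placeAB⁻ S⊆A , independent-placeAB-with-a⁻ u S ind))))
      ... | false with independent-deleteColumn (deleteColumn R a) A₀ b′ S (independent-placeAB-without-a⁻ u S ind)
      ...   | S₀ , S₀⊆S , ind₀ , count≤ =
        ≤-trans (count-cons≤ u S) (s≤s (≤-trans count≤ (s≤s (count≤rankSub I₂ A₀ S₀ (S₀⊆A₀ , ind₀)))))
        where
        S₀⊆A₀ : S₀ ⊆ A₀
        S₀⊆A₀ i p = ⊆-placeAB⁻ S⊆A i (S₀⊆S i p)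

  private
    I₁ : SimpleGraph (suc m)
    I₁ = deleteVertex I a

    rankSub-placeAB-ff : ∀ V → rankSub I (placeAB false false V) ≡ rankSub I₂ V
    rankSub-placeAB-ff V =
      trans (rankSub-deleteVertex I a false (insertAt V b′ false) (λ ())) (rankSub-deleteVertex I₁ b′ false V (λ ()))

    rankSub-placeAB-f : ∀ y V → rankSub I (placeAB false y V) ≡ rankSub I₁ (insertAt V b′ y)
    rankSub-placeAB-f y V = rankSub-deleteVertex I a false (insertAt V b′ y) (λ ())

    rankSub-placeAB-tf : ∀ V → rankSub I (placeAB true false V) ≡ rankSub I₁ (insertAt V b′ false)
    rankSub-placeAB-tf V = rankSub-deleteVertex I a true (insertAt V b′ false) isolated
      where
      isolated : true ≡ true → ∀ j → lookup (insertAt V b′ false) j ≡ true → M a (punchIn a j) ≡ false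
      isolated _ j j∈ with punchInView b′ j
      ... | at         = ⊥-elim (false≢true (trans (sym (insertAt-lookup V b′ false)) j∈))
      ... | punched j′ = a-leaf j′

    complement-placeAB : ∀ x y V → complement (placeAB x y V) ≡ placeAB (not x) (not y) (complement V)
    complement-placeAB x y V =
      trans (complement-insertAt _ a x) (cong (λ W → insertAt W a (not x)) (complement-insertAt V b′ y))

  partialDualGenus-placeAB-same : ∀ x V → partialDualGenus I (placeAB x x V) ≡ 2 + partialDualGenus I₂ V
  partialDualGenus-placeAB-same true V rewrite complement-placeAB true true V =
    cong₂ _+_ (rankSub-placeAB V) (rankSub-placeAB-ff (complement V))
  partialDualGenus-placeAB-same false V rewrite complement-placeAB false false V =
    trans (cong₂ _+_ (rankSub-placeAB-ff V) (rankSub-placeAB (complement V)))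
          (ℕ+.x∙yz≈y∙xz (rankSub I₂ V) 2 (rankSub I₂ (complement V)))

  partialDualGenus-placeAB-opposite : ∀ x V → partialDualGenus I (placeAB x (not x) V)
                                              ≡ partialDualGenus I₁ (insertAt V b′ (not x))
  partialDualGenus-placeAB-opposite true V
    rewrite complement-placeAB true false V | complement-insertAt V b′ false =
    cong₂ _+_ (rankSub-placeAB-tf V) (rankSub-placeAB-f true (complement V))
  partialDualGenus-placeAB-opposite false V
    rewrite complement-placeAB false true V | complement-insertAt V b′ true =
    cong₂ _+_ (rankSub-placeAB-f true V) (rankSub-placeAB-tf (complement V))

  partialDualGenusPoly-leaf : ∀ k → partialDualGenusPoly I k
                                    ≡ (partialDualGenusPoly I₁ +ₚ twoZ²* (partialDualGenusPoly I₂)) k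
  partialDualGenusPoly-leaf k = begin
    partialDualGenusPoly I k
      ≡⟨ trans (subsetPoly-insertAt (partialDualGenus I) a k)
               (cong₂ _+_ (subsetPoly-insertAt (λ W → partialDualGenus I (insertAt W a false)) b′ k)
                          (subsetPoly-insertAt (λ W → partialDualGenus I (insertAt W a true)) b′ k)) ⟩
    (g false false + g false true) + (g true false + g true true)
      ≡⟨ cong₂ _+_ (cong₂ _+_ (same false) (opposite false)) (cong₂ _+_ (opposite true) (same true)) ⟩
    (E + G true) + (G false + E)
      ≡⟨ rearrange E (G true) (G false) ⟩
    (G false + G true) + (E + E)
      ≡⟨ cong₂ _+_ (subsetPoly-insertAt (partialDualGenus I₁) b′ k) (twoZ²*-subsetPoly (partialDualGenus I₂) k) ⟨
    partialDualGenusPoly I₁ k + twoZ²* (partialDualGenusPoly I₂) k ∎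
    where
    open ≡-Reasoning
    g : Bool → Bool → ℕ
    g x y = subsetPoly (λ V → partialDualGenus I (placeAB x y V)) k
    G : Bool → ℕ
    G y = subsetPoly (λ V → partialDualGenus I₁ (insertAt V b′ y)) k
    E : ℕ
    E = subsetPoly (λ V → 2 + partialDualGenus I₂ V) k
    same : ∀ x → g x x ≡ E
    same x = subsetPoly-cong (partialDualGenus-placeAB-same x) k
    opposite : ∀ x → g x (not x) ≡ G (not x)
    opposite x = subsetPoly-cong (partialDualGenus-placeAB-opposite x) k
    rearrange : ∀ e x y → (e + x) + (y + e) ≡ (y + x) + (e + e)
    rearrange = solve-∀

degree-one⇒leaf : (I : SimpleGraph (suc n)) (a b : Fin (suc n)) → adj I a b ≡ true → degree I a ≡ 1 →
                  ∀ j → j ≢ b → adj I a j ≡ false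
degree-one⇒leaf I a b a-b deg j j≢b with punchInView b j
... | at         = ⊥-elim (j≢b refl)
... | punched j′ =
  trans (sym (lookup∘tabulate (λ i → adj I a (punchIn b i)) j′)) (count≡0⇒empty others others≡0 j′)
  where
  others : Subset _
  others = tabulate λ i → adj I a (punchIn b i)

  others≡0 : count others ≡ 0
  others≡0 = suc-injective (begin
    suc (count others)                       ≡⟨ cong (λ x → count (x ∷ others)) a-b ⟨
    count (adj I a b ∷ others)               ≡⟨ count-insertAt others b (adj I a b) ⟨
    count (insertAt others b (adj I a b))    ≡⟨ cong count (tabulate-insertAt (adj I a) b) ⟨
    degree I a                               ≡⟨ deg ⟩
    1                                        ∎)
    where open ≡-Reasoning

theorem4p1 : ∀ {m} (I : SimpleGraph (suc (suc m))) (a b : Fin (suc (suc m)))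
    → (ab : adj I a b ≡ true) → degree I a ≡ 1
    → ∀ k → partialDualGenusPoly I k
          ≡ (partialDualGenusPoly (deleteVertex I a)
             +ₚ twoZ²* (partialDualGenusPoly (deleteTwo I a b (adj⇒≢ I ab)))) k
theorem4p1 {m} I a b ab deg = partialDualGenusPoly-leaf I a b′ a-b′ a-leaf
  where
  b′ : Fin (suc m)
  b′ = punchOut (adj⇒≢ I ab)
  b≡ : punchIn a b′ ≡ b
  b≡ = punchIn-punchOut (adj⇒≢ I ab)
  a-b′ : adj I a (punchIn a b′) ≡ true
  a-b′ = trans (cong (adj I a) b≡) ab
  a-leaf : ∀ j → adj I a (punchIn a (punchIn b′ j)) ≡ false
  a-leaf j = degree-one⇒leaf I a b ab deg _ λ eq → punchInᵢ≢i b′ j (punchIn-injective a _ _ (trans eq (sym b≡)))
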